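{- Let $2\le k<g$ be integers. Every node of the Young graph $Y(g,k)$ is a predecessor of the node $[0,0]$, i.e. there is a directed path in $Y(g,k)$ from it to $[0,0]$.
   Context: For integers $2\le k<g$, the labeled directed graph $H(g,k)$ has a distinguished starting node $[[0,0]]$ and other nodes labeled by pairs $[R,r]$ of integers with $0\le R,r\le k-1$ (the node $[0,0]$ is distinct from the starting node). For a node $[P,p]$ (the starting node treated as $[0,0]$ here) there is an edge labeled $(A,a)$ from $[P,p]$ to $[R,r]$ whenever $0\le A,a\le g-1$ are integers, $0\le R,r\le k-1$, $ka+p=A+rg$ and $kA+R=a+Pg$; edges leaving the starting node additionally require $A\ne0\ne a$; no edge enters the starting node. $H(g,k)$ consists of the starting node and all nodes reachable from it. An even pivot node is a node $[a,a]$; an odd pivot node is a node $[r,s]$ with an edge to $[s,r]$; the starting node is not a pivot node. $Y(g,k)$ is obtained from $H(g,k)$ by deleting every node that is not a pivot node and from which no pivot node is reachable, with incident edges. -}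

module Defs where

open import Data.Nat using (ℕ; _+_; _*_; _<_)
open import Data.Product using (Σ; _×_; proj₁; proj₂; _,_)
open import Data.Sum using (_⊎_)
open import Data.Empty using (⊥)
open import Relation.Nullary using (¬_)
open import Relation.Binary.PropositionalEquality using (_≡_)
open import Relation.Binary.Construct.Closure.ReflexiveTransitive using (Star)

-- Nodes of the ambient graph: the distinguished starting node [[0,0]]
-- and pair nodes [R,r].  Bounds 0 ≤ R,r ≤ k-1 are imposed on edge
-- targets, so only in-range pair nodes are ever reachable from start.
data Node : Set where
  start : Node
  pt    : ℕ → ℕ → Node

fstC : Node → ℕ
fstC start    = 0
fstC (pt P p) = P

sndC : Node → ℕ
sndC start    = 0
sndC (pt P p) = p

data Edge (g k : ℕ) (u : Node) : Node → Set where
  edge : (A a R r : ℕ) → A < g → a < g → R < k → r < k →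
         k * a + sndC u ≡ A + r * g →
         k * A + R ≡ a + fstC u * g →
         (u ≡ start → ¬ (A ≡ 0) × ¬ (a ≡ 0)) →
         Edge g k u (pt R r)

Reach : ℕ → ℕ → Node → Node → Set
Reach g k = Star (Edge g k)

InH : ℕ → ℕ → Node → Set
InH g k v = Reach g k start v

EvenPivot : Node → Set
EvenPivot start    = ⊥
EvenPivot (pt R r) = R ≡ r

OddPivot : ℕ → ℕ → Node → Set
OddPivot g k start    = ⊥
OddPivot g k (pt r s) = Edge g k (pt r s) (pt s r)

Pivot : ℕ → ℕ → Node → Set
Pivot g k v = EvenPivot v ⊎ OddPivot g k v

-- v is a node of Y(g,k): a node of H(g,k) that is a pivot node or
-- from which some pivot node is reachable (within H(g,k); every node
-- reachable from a node of H is itself in H).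
InY : ℕ → ℕ → Node → Set
InY g k v = InH g k v × (Pivot g k v ⊎ Σ Node (λ w → Reach g k v w × Pivot g k w))

EdgeY : ℕ → ℕ → Node → Node → Set
EdgeY g k u v = InY g k u × InY g k v × Edge g k u v

PathY : ℕ → ℕ → Node → Node → Set
PathY g k = Star (EdgeY g k)

-- The key observation is a symmetry of the edge equations: an edge
-- [P,p] → [R,r] labelled (A,a) yields an edge [r,R] → [p,P] labelled
-- (a,A), because the two defining equations simply exchange roles.
-- Hence every path u ⇝ v between in-range nodes reverses to a path
-- swap v ⇝ swap u, and the starting node behaves as [0,0] = swap start.
--
-- Now let v be a node of Y, reaching a pivot w.  A pivot w reaches its
-- own swap (trivially for [a,a], by its defining edge for an odd pivot),
-- and reversing the path start ⇝ v ⇝ w gives swap w ⇝ [0,0].  So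
-- v ⇝ w ⇝ swap w ⇝ [0,0].  Finally, any path from a node of H(g,k) that
-- ends at a pivot runs entirely inside Y(g,k), since each node on it
-- lies in H and reaches that pivot; this lifts the path to Y.
module Submission where

open import Defs
open import Data.Nat using (ℕ; _≤_; _<_; s≤s; z≤n)
open import Data.Product using (_×_; _,_)
open import Data.Sum using (_⊎_; inj₁; inj₂)
open import Relation.Binary.PropositionalEquality using (refl)
open import Relation.Binary.Construct.Closure.ReflexiveTransitive using (ε; _◅_; _◅◅_)

swap : Node → Node
swap u = pt (sndC u) (fstC u)

InRange : ℕ → Node → Set
InRange k u = fstC u < k × sndC u < k

edge-target-inRange : ∀ {g k u v} → Edge g k u v → InRange k v
edge-target-inRange (edge _ _ _ _ _ _ R<k r<k _ _ _) = R<k , r<k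

reach-inRange : ∀ {g k u v} → InRange k u → Reach g k u v → InRange k v
reach-inRange inU ε       = inU
reach-inRange inU (e ◅ p) = reach-inRange (edge-target-inRange e) p

-- The source u must be in range because it becomes
-- the new target; the new source is never start, so no extra condition.
reverse-edge : ∀ {g k u v} → InRange k u → Edge g k u v → Edge g k (swap v) (swap u)
reverse-edge (P<k , p<k) (edge A a _ _ A<g a<g _ _ eq₁ eq₂ _) =
  edge a A _ _ a<g A<g p<k P<k eq₂ eq₁ (λ ())

reverse-path : ∀ {g k u v} → InRange k u → Reach g k u v → Reach g k (swap v) (swap u)
reverse-path inU ε       = ε
reverse-path inU (e ◅ p) = reverse-path (edge-target-inRange e) p ◅◅ (reverse-edge inU e ◅ ε)

pivot-reaches-swap : ∀ {g k w} → Pivot g k w → Reach g k w (swap w)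
pivot-reaches-swap {w = start}  (inj₁ ())
pivot-reaches-swap {w = start}  (inj₂ ())
pivot-reaches-swap {w = pt a b} (inj₁ refl) = ε
pivot-reaches-swap {w = pt a b} (inj₂ e)    = e ◅ ε

-- A node of H(g,k) reaching a pivot w also reaches [0,0]: go to w, then to
-- swap w, then back along the reversal of start ⇝ w (start is in range
-- as soon as 0 < k).
reach-origin : ∀ {g k v w} → 0 < k → InH g k v → Reach g k v w → Pivot g k w →
               Reach g k v (pt 0 0)
reach-origin 0<k hv v⇝w pw =
  v⇝w ◅◅ pivot-reaches-swap pw ◅◅ reverse-path (0<k , 0<k) (hv ◅◅ v⇝w)

path-in-Y : ∀ {g k u z} → InH g k u → Reach g k u z → Pivot g k z → PathY g k u z
path-in-Y hu ε pz = ε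
path-in-Y {z = z} hu (e ◅ p) pz =
  ((hu , inj₂ (z , e ◅ p , pz)) , (hv , inj₂ (z , p , pz)) , e) ◅ path-in-Y hv p pz
  where hv = hu ◅◅ (e ◅ ε)

-- The theorem: only 0 < k is actually needed; [0,0] is an even pivot, so
-- the path to it lifts to Y(g,k).
corollary1 : (g k : ℕ) → 2 ≤ k → k < g →
    (v : Node) → InY g k v → PathY g k v (pt 0 0)
corollary1 g k (s≤s _) k<g v (hv , inj₁ pv) =
  path-in-Y hv (reach-origin (s≤s z≤n) hv ε pv) (inj₁ refl)
corollary1 g k (s≤s _) k<g v (hv , inj₂ (w , v⇝w , pw)) =
  path-in-Y hv (reach-origin (s≤s z≤n) hv v⇝w pw) (inj₁ refl)
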